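{- Let $X$ and $Y$ be topological spaces with prescribed lattice bases $L$ and $M$ respectively, and let $f\colon X\to Y$ be a function; write $f^{ -1}[-]\colon\mathcal{P}(Y)\to\mathcal{P}(X)$ for the inverse-image map. (1) $f$ is bases-continuous if and only if $f^{ -1}$ restricts to a lattice homomorphism $f^*\coloneqq f^{ -1}\colon M\to L$. When these equivalent conditions hold and $f$ is surjective, $f^*$ is injective. (2) Assume further that $L$ and $M$ are Heyting bases and that $f$ is bases-continuous and bases-open. Then $f^{ -1}$ restricts to a homomorphism of Heyting algebras $f^*\colon M\to L$. Moreover, if $f$ is injective then $f^*$ is surjective, and if $f$ is a bijection then $f^*$ is an isomorphism.
   Context: For a topological space $X$ with lattice of open sets $\mathrm{Opens}(X)$ (a Heyting algebra with $U\to V=\mathrm{Int}((X\setminus U)\cup V)$), a lattice basis is a sublattice $L$ of $\mathrm{Opens}(X)$ (containing $\emptyset$ and $X$) which is a basis of the topology; a Heyting basis is a lattice basis which is moreover a Heyting subalgebra of $\mathrm{Opens}(X)$. For spaces $X,Y$ with lattice bases $L,M$, a function $f\colon X\to Y$ is bases-continuous if $f^{ -1}[S]\in L$ for every $S\in M$, and bases-open if $f[U]\in M$ for every $U\in L$. $\mathcal{P}(A)$ is the power set of $A$. -}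

module Defs where

open import Level using (Level; _⊔_; suc; Lift)
open import Data.Empty using (⊥)
open import Data.Unit using (⊤)
open import Data.Product using (Σ; ∃; _×_; _,_)
open import Data.Sum using (_⊎_)
open import Relation.Nullary using (¬_)
open import Relation.Binary.PropositionalEquality using (_≡_)
open import Relation.Unary using (Pred; _∈_; _⊆_; _≐_; _∩_; _∪_; ⋃; _⊢_)

-- Subsets of a carrier are predicates at a fixed level ℓ (the carrier level);
-- equality of subsets is extensional equality _≐_.

∅ₗ : ∀ {ℓ} {X : Set ℓ} → Pred X ℓ
∅ₗ = λ _ → Lift _ ⊥

Whole : ∀ {ℓ} {X : Set ℓ} → Pred X ℓ
Whole = λ _ → Lift _ ⊤

_⇨_ : ∀ {ℓ} {X : Set ℓ} → Pred X ℓ → Pred X ℓ → Pred X ℓ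
U ⇨ V = (λ x → ¬ (U x)) ∪ V

image : ∀ {ℓ} {X Y : Set ℓ} → (X → Y) → Pred X ℓ → Pred Y ℓ
image f U = λ y → ∃ λ x → U x × f x ≡ y

preimage : ∀ {ℓ} {X Y : Set ℓ} → (X → Y) → Pred Y ℓ → Pred X ℓ
preimage f S = f ⊢ S

record Space (ℓ ℓ' : Level) : Set (suc (ℓ ⊔ ℓ')) where
  field
    Carrier : Set ℓ
    Open    : Pred (Pred Carrier ℓ) ℓ'
    open-resp   : ∀ {U V} → U ≐ V → Open U → Open V
    open-∅      : Open ∅ₗ
    open-whole  : Open Whole
    open-∩      : ∀ {U V} → Open U → Open V → Open (U ∩ V)
    open-⋃      : (I : Set ℓ) (F : I → Pred Carrier ℓ) → (∀ i → Open (F i)) → Open (⋃ I F)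

module _ {ℓ ℓ' : Level} (T : Space ℓ ℓ') where
  open Space T

  IsInterior : Pred Carrier ℓ → Pred Carrier ℓ → Set (suc ℓ ⊔ ℓ')
  IsInterior W S = Open W × W ⊆ S × (∀ O → Open O → O ⊆ S → O ⊆ W)

  -- lattice basis: sublattice of Opens(X) containing ∅ and X that is a basis.
  -- (membership in L is invariant under extensional equality of subsets,
  -- reflecting that L is a set of subsets)
  record LatticeBasis {ℓL : Level} (L : Pred (Pred Carrier ℓ) ℓL) : Set (suc ℓ ⊔ ℓ' ⊔ ℓL) where
    field
      resp   : ∀ {U V} → U ≐ V → L U → L V
      open⊆  : ∀ U → L U → Open U
      has-∅  : L ∅ₗ
      has-X  : L Whole
      has-∩  : ∀ {U V} → L U → L V → L (U ∩ V)
      has-∪  : ∀ {U V} → L U → L V → L (U ∪ V)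
      basis  : ∀ O → Open O → ∀ x → O x → Σ (Pred Carrier ℓ) λ B → L B × B x × B ⊆ O

  record HeytingBasis {ℓL : Level} (L : Pred (Pred Carrier ℓ) ℓL) : Set (suc ℓ ⊔ ℓ' ⊔ ℓL) where
    field
      lattice : LatticeBasis L
      has-⇒   : ∀ {U V} → L U → L V → Σ (Pred Carrier ℓ) λ W → L W × IsInterior W (U ⇨ V)

module _ {ℓ ℓ₁ ℓ₂ ℓL ℓM : Level} (TX : Space ℓ ℓ₁) (TY : Space ℓ ℓ₂)
         (L : Pred (Pred (Space.Carrier TX) ℓ) ℓL) (M : Pred (Pred (Space.Carrier TY) ℓ) ℓM)
         (f : Space.Carrier TX → Space.Carrier TY) where

  private
    X = Space.Carrier TX
    Y = Space.Carrier TY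

  BasesContinuous : Set (suc ℓ ⊔ ℓL ⊔ ℓM)
  BasesContinuous = ∀ S → M S → L (preimage f S)

  BasesOpen : Set (suc ℓ ⊔ ℓL ⊔ ℓM)
  BasesOpen = ∀ U → L U → M (image f U)

  record RestrictsToLatticeHom : Set (suc ℓ ⊔ ℓL ⊔ ℓM) where
    field
      maps   : ∀ S → M S → L (preimage f S)
      pres-∅ : preimage f ∅ₗ ≐ ∅ₗ
      pres-X : preimage f Whole ≐ Whole
      pres-∧ : ∀ S T → M S → M T → preimage f (S ∩ T) ≐ (preimage f S ∩ preimage f T)
      pres-∨ : ∀ S T → M S → M T → preimage f (S ∪ T) ≐ (preimage f S ∪ preimage f T)

  -- f⁻¹ restricts to a Heyting algebra homomorphism f* : M → L, where the
  -- implication S → T in Opens(Y) is Int((Y ∖ S) ∪ T) and likewise in Opens(X)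
  record RestrictsToHeytingHom : Set (suc ℓ ⊔ ℓ₁ ⊔ ℓ₂ ⊔ ℓL ⊔ ℓM) where
    field
      latticeHom : RestrictsToLatticeHom
      pres-⇒     : ∀ S T W → M S → M T → M W → IsInterior TY W (S ⇨ T) →
                   IsInterior TX (preimage f W) (preimage f S ⇨ preimage f T)

  PullbackInjective : Set (suc ℓ ⊔ ℓM)
  PullbackInjective = ∀ S T → M S → M T → preimage f S ≐ preimage f T → S ≐ T

  PullbackSurjective : Set (suc ℓ ⊔ ℓL ⊔ ℓM)
  PullbackSurjective = ∀ U → L U → Σ (Pred Y ℓ) λ S → M S × preimage f S ≐ U

  PullbackHeytingIso : Set (suc ℓ ⊔ ℓ₁ ⊔ ℓ₂ ⊔ ℓL ⊔ ℓM)
  PullbackHeytingIso = RestrictsToHeytingHom × PullbackInjective × PullbackSurjective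

{-# OPTIONS --safe #-}
module Submission where

-- Preimage commutes with ∅, X, ∩, ∪ and with (X ∖ U) ∪ V, so the lattice part is
-- immediate and only the interior needs an argument.  Every open O ⊆ f⁻¹[S] is a
-- union of basis sets B, and bases-openness makes f[B] an open subset of S, hence
-- f[B] ⊆ Int S; so O ⊆ f⁻¹[Int S].  Surjectivity lets f⁻¹ reflect ⊆, and
-- injectivity gives f⁻¹[f[U]] = U, which is the preimage surjectivity.

open import Defs
open import Level using (Level)
open import Data.Product using (_×_; _,_)
open import Relation.Unary using (Pred; _⊆_; _≐_)
open import Relation.Unary.Properties using (≐-refl)
open import Relation.Binary.PropositionalEquality using (_≡_; refl; subst; sym)
open import Function.Bundles using (_⇔_; mk⇔)
open import Function.Definitions using (Injective; Surjective; Bijective)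

module _ {ℓ : Level} {X Y : Set ℓ} (f : X → Y) where

  image⊆⇐⊆preimage : ∀ {B : Pred X ℓ} {S : Pred Y ℓ} → B ⊆ preimage f S → image f B ⊆ S
  image⊆⇐⊆preimage B⊆f⁻¹S (_ , Bx , refl) = B⊆f⁻¹S Bx

  surjective⇒preimage-reflects-⊆ : Surjective _≡_ _≡_ f →
    ∀ {S T : Pred Y ℓ} → preimage f S ⊆ preimage f T → S ⊆ T
  surjective⇒preimage-reflects-⊆ surj {S} {T} f⁻¹S⊆f⁻¹T {y} Sy =
    let (_ , fx≡y) = surj y in
    subst T (fx≡y refl) (f⁻¹S⊆f⁻¹T (subst S (sym (fx≡y refl)) Sy))

  surjective⇒preimage-injective : Surjective _≡_ _≡_ f →
    ∀ {S T : Pred Y ℓ} → preimage f S ≐ preimage f T → S ≐ T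
  surjective⇒preimage-injective surj {S} {T} (⊆ , ⊇) =
    surjective⇒preimage-reflects-⊆ surj {S} {T} ⊆ , surjective⇒preimage-reflects-⊆ surj {T} {S} ⊇

  injective⇒preimage-image : Injective _≡_ _≡_ f → ∀ (U : Pred X ℓ) → preimage f (image f U) ≐ U
  injective⇒preimage-image inj U = (λ (_ , Ux′ , fx′≡fx) → subst U (inj fx′≡fx) Ux′)
                                  , (λ Ux → _ , Ux , refl)

module _ {ℓ ℓ₁ ℓ₂ ℓL : Level} {TX : Space ℓ ℓ₁} {TY : Space ℓ ℓ₂}
         {L : Pred (Pred (Space.Carrier TX) ℓ) ℓL}
         (LB : LatticeBasis TX L) (f : Space.Carrier TX → Space.Carrier TY) where

  open Space
  open LatticeBasis LB using (basis)

  preimage-interior : (∀ U → L U → Open TY (image f U)) →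
    ∀ {W S} → Open TX (preimage f W) → IsInterior TY W S →
    IsInterior TX (preimage f W) (preimage f S)
  preimage-interior image-open {W} {S} f⁻¹W-open (_ , W⊆S , W-largest) =
    f⁻¹W-open , W⊆S , f⁻¹W-largest
    where
    f⁻¹W-largest : ∀ O → Open TX O → O ⊆ preimage f S → O ⊆ preimage f W
    f⁻¹W-largest O O-open O⊆f⁻¹S {x} Ox =
      let (B , LB , Bx , B⊆O) = basis O O-open x Ox in
      W-largest (image f B) (image-open B LB)
        (image⊆⇐⊆preimage f (λ Bx′ → O⊆f⁻¹S (B⊆O Bx′))) (x , Bx , refl)

module _ {ℓ ℓ₁ ℓ₂ ℓL ℓM : Level} {TX : Space ℓ ℓ₁} {TY : Space ℓ ℓ₂}
         {L : Pred (Pred (Space.Carrier TX) ℓ) ℓL} {M : Pred (Pred (Space.Carrier TY) ℓ) ℓM}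
         (f : Space.Carrier TX → Space.Carrier TY) where

  continuous⇒restrictsToLatticeHom : BasesContinuous TX TY L M f → RestrictsToLatticeHom TX TY L M f
  continuous⇒restrictsToLatticeHom cont = record
    { maps   = cont
    ; pres-∅ = ≐-refl
    ; pres-X = ≐-refl
    ; pres-∧ = λ _ _ _ _ → ≐-refl
    ; pres-∨ = λ _ _ _ _ → ≐-refl
    }

  continuous∧open⇒restrictsToHeytingHom : LatticeBasis TX L → LatticeBasis TY M →
    BasesContinuous TX TY L M f → BasesOpen TX TY L M f →
    RestrictsToHeytingHom TX TY L M f
  continuous∧open⇒restrictsToHeytingHom LB MB cont open′ = record
    { latticeHom = continuous⇒restrictsToLatticeHom cont
    ; pres-⇒     = λ _ _ W _ _ MW →
        preimage-interior {TY = TY} LB f (λ U LU → LatticeBasis.open⊆ MB _ (open′ U LU))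
          (LatticeBasis.open⊆ LB _ (cont W MW))
    }

  open⇒pullback-surjective : BasesOpen TX TY L M f → Injective _≡_ _≡_ f →
    PullbackSurjective TX TY L M f
  open⇒pullback-surjective open′ inj U LU = image f U , open′ U LU , injective⇒preimage-image f inj U

lemma4p1 : ∀ {ℓ ℓ₁ ℓ₂ ℓL ℓM : Level} (TX : Space ℓ ℓ₁) (TY : Space ℓ ℓ₂)
           (L : Pred (Pred (Space.Carrier TX) ℓ) ℓL) (M : Pred (Pred (Space.Carrier TY) ℓ) ℓM) →
           LatticeBasis TX L → LatticeBasis TY M →
           (f : Space.Carrier TX → Space.Carrier TY) →
           -- (1)
           ((BasesContinuous TX TY L M f ⇔ RestrictsToLatticeHom TX TY L M f)
            × (BasesContinuous TX TY L M f → Surjective _≡_ _≡_ f → PullbackInjective TX TY L M f))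
           × -- (2)
           (HeytingBasis TX L → HeytingBasis TY M →
            BasesContinuous TX TY L M f → BasesOpen TX TY L M f →
            RestrictsToHeytingHom TX TY L M f
            × (Injective _≡_ _≡_ f → PullbackSurjective TX TY L M f)
            × (Bijective _≡_ _≡_ f → PullbackHeytingIso TX TY L M f))
lemma4p1 TX TY L M LB MB f =
  ( mk⇔ (continuous⇒restrictsToLatticeHom f) RestrictsToLatticeHom.maps
  , λ _ surj _ _ _ _ → surjective⇒preimage-injective f surj )
  , λ _ _ cont open′ →
      let heytingHom = continuous∧open⇒restrictsToHeytingHom f LB MB cont open′ in
      heytingHom
      , pullback-surjective open′
      , λ (inj , surj) → heytingHom
                       , (λ _ _ _ _ → surjective⇒preimage-injective f surj)
                       , pullback-surjective open′ inj
  where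
  pullback-surjective : BasesOpen TX TY L M f → Injective _≡_ _≡_ f → PullbackSurjective TX TY L M f
  pullback-surjective = open⇒pullback-surjective {TX = TX} {TY = TY} {L = L} {M = M} f
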